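{- Let $q$ be a prime power, $s\ge2$, $m\ge1$, and let $G$ be the generator matrix of $\mathcal{RM}_q(1,s-1)$ whose $i$-th column is $(1,v_i)^T$, where $v_1,\dots,v_n$ ($n=q^{s-1}$) is an enumeration of $\mathbb{F}_q^{s-1}$; view $v_i$ as a point of the affine space $\mathrm{AG}(s-1,q)$. If $\mathbf{c}$ is a word of weight $q^{s-1}-q^{s-1-m}$ in the extension code $\mathcal{RM}_q(1,s-1)\otimes\mathbb{F}_{q^m}$, then $\{v_i : i\in[n]\setminus\mathrm{supp}(\mathbf{c})\}$ is the set of all points of some affine subspace of $\mathrm{AG}(s-1,q)$ of codimension $m$.
   Context: The first order $q$-ary Reed–Muller code $\mathcal{RM}_q(1,s-1)$ is the linear $[q^{s-1},s]$ code over $\mathbb{F}_q$ generated by $G$. The extension code $C\otimes\mathbb{F}_{q^m}$ is the $\mathbb{F}_{q^m}$-linear span of $C$ in $\mathbb{F}_{q^m}^n$. $\mathrm{supp}(\mathbf{c})$ is the set of nonzero coordinates of $\mathbf{c}$ and $[n]=\{1,\dots,n\}$. -}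

module Defs where

open import Level using (0ℓ)
open import Data.Nat using (ℕ; zero; suc; _^_)
import Data.Nat as ℕ
open import Data.Nat.Primality using (Prime)
open import Data.Fin using (Fin; zero; suc)
open import Data.Product using (Σ; ∃; _×_; _,_)
open import Data.Empty using (⊥)
open import Relation.Nullary using (¬_; Dec; yes; no)
open import Relation.Binary using (Decidable)
open import Relation.Binary.PropositionalEquality using (_≡_)
open import Algebra.Bundles using (CommutativeRing)
import Algebra.Morphism.Structures as MS

IsPrimePower : ℕ → Set
IsPrimePower q = Σ ℕ λ p → Σ ℕ λ k → Prime p × (q ≡ p ^ suc k)

record FiniteField (q : ℕ) : Set₁ where
  field
    cring : CommutativeRing 0ℓ 0ℓ
  open CommutativeRing cring public
  field
    _≟_      : Decidable _≈_
    0≉1      : ¬ (0# ≈ 1#)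
    inverse  : ∀ x → ¬ (x ≈ 0#) → Σ Carrier λ y → (x * y) ≈ 1#
    enum     : Fin q → Carrier
    enum-inj : ∀ i j → enum i ≈ enum j → i ≡ j
    enum-sur : ∀ x → Σ (Fin q) λ i → enum i ≈ x

module _ {q : ℕ} (F : FiniteField q) where
  open FiniteField F using (Carrier; _≈_; _+_; _*_; 0#)

  ∑ : (d : ℕ) → (Fin d → Carrier) → Carrier
  ∑ zero    f = 0#
  ∑ (suc d) f = f zero + ∑ d (λ k → f (suc k))

  Pt : ℕ → Set
  Pt r = Fin r → Carrier

  _≈ᵥ_ : {r : ℕ} → Pt r → Pt r → Set
  x ≈ᵥ y = ∀ j → x j ≈ y j

  affComb : {r d : ℕ} → Pt r → (Fin d → Pt r) → (Fin d → Carrier) → Pt r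
  affComb p u ls j = p j + ∑ _ (λ k → ls k * u k j)

  LinIndep : {r d : ℕ} → (Fin d → Pt r) → Set
  LinIndep {r} {d} u = ∀ (ls : Fin d → Carrier) →
    (∀ j → ∑ d (λ k → ls k * u k j) ≈ 0#) → ∀ k → ls k ≈ 0#

  IsAffineSubspaceOfCodim : (r m : ℕ) → (Pt r → Set) → Set
  IsAffineSubspaceOfCodim r m P =
    Σ ℕ λ d → (d ℕ.+ m ≡ r) × Σ (Pt r) λ p → Σ (Fin d → Pt r) λ u →
      LinIndep u ×
      (∀ x → (P x → Σ (Fin d → Carrier) λ ls → x ≈ᵥ affComb p u ls)
           × ((Σ (Fin d → Carrier) λ ls → x ≈ᵥ affComb p u ls) → P x))

record Extension {q : ℕ} (F : FiniteField q) (m : ℕ) : Set₁ where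
  field
    K   : FiniteField (q ^ m)
    ι   : FiniteField.Carrier F → FiniteField.Carrier K
    ι-hom : MS.RingMorphisms.IsRingHomomorphism
              (CommutativeRing.rawRing (FiniteField.cring F))
              (CommutativeRing.rawRing (FiniteField.cring K)) ι

module _ {q : ℕ} (K : FiniteField q) where
  open FiniteField K using (Carrier; _≈_; _≟_; 0#)

  wt : {n : ℕ} → (Fin n → Carrier) → ℕ
  wt {zero}  c = 0
  wt {suc n} c with c zero ≟ 0#
  ... | yes _ = wt (λ i → c (suc i))
  ... | no  _ = suc (wt (λ i → c (suc i)))

genRM : {q r n : ℕ} (F : FiniteField q) → (Fin n → Pt F r) →
        Fin (suc r) → Fin n → FiniteField.Carrier F
genRM F v zero    i = FiniteField.1# F
genRM F v (suc j) i = v i j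

-- c lies in the F_{q^m}-span of the rows of G (the extension code C ⊗ F_{q^m})
InExtensionCode : {q m k n : ℕ} {F : FiniteField q} (E : Extension F m) →
                  (Fin k → Fin n → FiniteField.Carrier F) →
                  (Fin n → FiniteField.Carrier (Extension.K E)) → Set
InExtensionCode {k = k} E G c =
  Σ (Fin k → K.Carrier) λ a → ∀ i → c i K.≈ ∑ K k (λ j → a j K.* ι (G j i))
  where open Extension E
        module K = FiniteField K

module Submission where

-- Write r = s - 1, n = q ^ r and K = F_{q^m}.  A word c of the
-- extension code has the form c_i = φ(v_i), where φ(x) = a₀ + L(x) for an
-- F-linear map L : F^r → K (L(x) = Σ_j a_j ι(x_j)).  Hence the zero set Z of c,
-- read as a set of points of AG(r, q), is either empty or a translate p + ker L.
-- Now ker L is a (decidable) F-subspace of F^r, so it has a basis u_1 .. u_d,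
-- and Z = { p + Σ_k λ_k u_k } with the λ ∈ F^d parametrising Z bijectively;
-- thus Z has exactly q ^ d points.  The weight hypothesis says
-- wt(c) · q^m + q^r = q^(r+m), and together with wt(c) + |Z| = q^r this gives
-- |Z| · q^m = q^r; so Z is nonempty, and q^(d+m) = q^r forces d + m = r.

open import Defs
open import Data.Nat as ℕ using (ℕ; zero; suc; _≤_; _<_; _∸_; _^_)
open import Data.Fin using (Fin; zero; suc; finToFun; funToFin; combine)
import Data.Fin.Properties as FinP
open import Data.Product using (Σ; _×_; _,_; proj₁; proj₂)
open import Data.Empty using (⊥-elim)
open import Function.Base using (_∘_)
open import Function.Definitions using (Injective)
open import Relation.Nullary using (¬_; Dec; yes; no)
open import Relation.Binary.PropositionalEquality as ≡ using (_≡_; cong; cong₂)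
import Relation.Binary.Reasoning.Setoid as SetoidReasoning
import Algebra.Properties.Ring as RingProperties
import Algebra.Properties.Group as GroupProperties
import Algebra.Properties.AbelianGroup as AbelianGroupProperties
import Algebra.Properties.Semiring.Sum as SemiringSum
import Algebra.Morphism.Structures as MorphismStructures

funToFin-cong : ∀ {m n} {f g : Fin m → Fin n} → (∀ i → f i ≡ g i) → funToFin f ≡ funToFin g
funToFin-cong {zero}  f≗g = ≡.refl
funToFin-cong {suc m} f≗g = cong₂ combine (f≗g zero) (funToFin-cong (f≗g ∘ suc))

module Space {q : ℕ} (F : FiniteField q) where
  open FiniteField F public hiding (zero)
  open SetoidReasoning setoid
  open SemiringSum semiring using (sum; sum-cong-≋; ∑-distrib-+; *-distribˡ-sum; sum-replicate-zero)
  open RingProperties ring using (-1*x≈-x; -‿distribˡ-*)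
  open GroupProperties +-group using (x∙y⁻¹≈ε⇒x≈y; x≈y⇒x∙y⁻¹≈ε; ∙-cancelˡ; //-rightDividesˡ)
  open AbelianGroupProperties +-abelianGroup using (xyx⁻¹≈y)

  infix 4 _≐_
  _≐_ : ∀ {r} → Pt F r → Pt F r → Set
  _≐_ = _≈ᵥ_ F

  ∑≈sum : ∀ d (f : Fin d → Carrier) → ∑ F d f ≈ sum f
  ∑≈sum zero    f = refl
  ∑≈sum (suc d) f = +-congˡ (∑≈sum d (f ∘ suc))

  ∑-cong : ∀ d {f g : Fin d → Carrier} → f ≐ g → ∑ F d f ≈ ∑ F d g
  ∑-cong d {f} {g} f≐g = begin
    ∑ F d f ≈⟨ ∑≈sum d f ⟩
    sum f   ≈⟨ sum-cong-≋ f≐g ⟩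
    sum g   ≈⟨ ∑≈sum d g ⟨
    ∑ F d g ∎

  ∑-zero : ∀ d {f : Fin d → Carrier} → (∀ k → f k ≈ 0#) → ∑ F d f ≈ 0#
  ∑-zero d f≈0 = trans (∑-cong d f≈0) (trans (∑≈sum d (λ _ → 0#)) (sum-replicate-zero d))

  ∑-+ : ∀ d (f g : Fin d → Carrier) → ∑ F d (λ k → f k + g k) ≈ ∑ F d f + ∑ F d g
  ∑-+ d f g = begin
    ∑ F d (λ k → f k + g k) ≈⟨ ∑≈sum d _ ⟩
    sum (λ k → f k + g k)   ≈⟨ ∑-distrib-+ f g ⟩
    sum f + sum g           ≈⟨ +-cong (∑≈sum d f) (∑≈sum d g) ⟨
    ∑ F d f + ∑ F d g       ∎

  ∑-* : ∀ d t (f : Fin d → Carrier) → ∑ F d (λ k → t * f k) ≈ t * ∑ F d f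
  ∑-* d t f = begin
    ∑ F d (λ k → t * f k) ≈⟨ ∑≈sum d _ ⟩
    sum (λ k → t * f k)   ≈⟨ *-distribˡ-sum t f ⟨
    t * sum f             ≈⟨ *-congˡ (∑≈sum d f) ⟨
    t * ∑ F d f           ∎

  ∑-neg : ∀ d (f : Fin d → Carrier) → ∑ F d (λ k → - f k) ≈ - ∑ F d f
  ∑-neg d f = begin
    ∑ F d (λ k → - f k)      ≈⟨ ∑-cong d (λ k → -1*x≈-x (f k)) ⟨
    ∑ F d (λ k → - 1# * f k) ≈⟨ ∑-* d (- 1#) f ⟩
    - 1# * ∑ F d f           ≈⟨ -1*x≈-x _ ⟩
    - ∑ F d f                ∎

  a+[b-a]≈b : ∀ a b → a + (b - a) ≈ b
  a+[b-a]≈b a b = trans (+-comm a (b - a)) (//-rightDividesˡ a b)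

  absorb-0 : ∀ {a b} → a ≈ 0# → a + b ≈ 0# → b ≈ 0#
  absorb-0 {a} {b} a≈0 a+b≈0 = trans (sym (+-identityˡ b)) (trans (+-congʳ (sym a≈0)) a+b≈0)

  0ᵥ : ∀ {r} → Pt F r
  0ᵥ j = 0#

  _+ᵥ_ : ∀ {r} → Pt F r → Pt F r → Pt F r
  (x +ᵥ y) j = x j + y j

  _·ᵥ_ : ∀ {r} → Carrier → Pt F r → Pt F r
  (t ·ᵥ x) j = t * x j

  _◃_ : ∀ {r} → Carrier → Pt F r → Pt F (suc r)
  (t ◃ y) zero    = t
  (t ◃ y) (suc j) = y j

  ◃-cong : ∀ {r} {t} {x y : Pt F r} → x ≐ y → (t ◃ x) ≐ (t ◃ y)
  ◃-cong x≐y zero    = refl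
  ◃-cong x≐y (suc j) = x≐y j

  first-zero : ∀ {r} (x : Pt F (suc r)) → x zero ≈ 0# → x ≐ (0# ◃ (x ∘ suc))
  first-zero x x₀≈0 zero    = x₀≈0
  first-zero x x₀≈0 (suc j) = refl

  lin : ∀ {r d} → (Fin d → Pt F r) → Pt F d → Pt F r
  lin u ls j = ∑ F _ (λ k → ls k * u k j)

  lin-cong : ∀ {r d} (u : Fin d → Pt F r) {ls ls′ : Pt F d} → ls ≐ ls′ → lin u ls ≐ lin u ls′
  lin-cong u ls≐ls′ j = ∑-cong _ (λ k → *-congʳ (ls≐ls′ k))

  lin-first-zero : ∀ {r d} (u : Fin d → Pt F r) ls → lin (λ k → 0# ◃ u k) ls zero ≈ 0#
  lin-first-zero u ls = ∑-zero _ (λ k → zeroʳ (ls k))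

  lin-injective : ∀ {r d} {u : Fin d → Pt F r} → LinIndep F u →
                  ∀ {e e′} → lin u e ≐ lin u e′ → e ≐ e′
  lin-injective {d = d} {u} independent {e} {e′} same k =
    x∙y⁻¹≈ε⇒x≈y (e k) (e′ k) (independent (λ k → e k - e′ k) difference-vanishes k)
    where
      difference-vanishes : ∀ j → ∑ F _ (λ k → (e k - e′ k) * u k j) ≈ 0#
      difference-vanishes j = begin
        ∑ F _ (λ k → (e k - e′ k) * u k j)
          ≈⟨ ∑-cong _ (λ k → trans (distribʳ (u k j) (e k) (- e′ k)) (+-congˡ (sym (-‿distribˡ-* (e′ k) (u k j))))) ⟩
        ∑ F _ (λ k → e k * u k j - e′ k * u k j)
          ≈⟨ ∑-+ d _ _ ⟩
        lin u e j + ∑ F _ (λ k → - (e′ k * u k j))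
          ≈⟨ +-congˡ (∑-neg d _) ⟩
        lin u e j - lin u e′ j
          ≈⟨ x≈y⇒x∙y⁻¹≈ε (same j) ⟩
        0# ∎

  -- F^r is enumerated by Fin (q ^ r), reading an index as r base-q digits.
  point : ∀ r → Fin (q ^ r) → Pt F r
  point r k j = enum (finToFun k j)

  point-injective : ∀ r {k k′} → point r k ≐ point r k′ → k ≡ k′
  point-injective r {k} {k′} same =
    ≡.trans (≡.sym (FinP.funToFin-finToFin {r} {q} k))
      (≡.trans (funToFin-cong (λ j → enum-inj _ _ (same j))) (FinP.funToFin-finToFin {r} {q} k′))

  point-onto : ∀ r (x : Pt F r) → Σ (Fin (q ^ r)) λ k → point r k ≐ x
  point-onto r x = funToFin digit , λ j →
    trans (reflexive (cong enum (FinP.finToFun-funToFin digit j))) (proj₂ (enum-sur (x j)))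
    where
      digit : Fin r → Fin q
      digit j = proj₁ (enum-sur (x j))

  search : ∀ r (Q : Pt F r → Set) → (∀ x → Dec (Q x)) → (∀ {x y} → x ≐ y → Q x → Q y) →
           Dec (Σ (Pt F r) Q)
  search r Q Q? Q-resp with FinP.any? (λ k → Q? (point r k))
  ... | yes (k , Qk) = yes (point r k , Qk)
  ... | no none = no λ (x , Qx) →
          none (proj₁ (point-onto r x) , Q-resp (λ j → sym (proj₂ (point-onto r x) j)) Qx)

  record IsSubspace {r} (W : Pt F r → Set) : Set where
    field
      decide   : ∀ x → Dec (W x)
      respects : ∀ {x y} → x ≐ y → W x → W y
      has-0    : W 0ᵥ
      closed-+ : ∀ {x y} → W x → W y → W (x +ᵥ y)
      closed-· : ∀ t {x} → W x → W (t ·ᵥ x)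

  record Basis {r} (W : Pt F r → Set) : Set where
    field
      dim         : ℕ
      vec         : Fin dim → Pt F r
      independent : LinIndep F vec
      inside      : ∀ k → W (vec k)
      spans       : ∀ x → W x → Σ (Pt F dim) λ ls → x ≐ lin vec ls

  lin-closed : ∀ {r} {W : Pt F r → Set} → IsSubspace W →
               ∀ {d} (u : Fin d → Pt F r) → (∀ k → W (u k)) → ∀ ls → W (lin u ls)
  lin-closed S {zero}  u u∈W ls = IsSubspace.has-0 S
  lin-closed S {suc d} u u∈W ls = IsSubspace.closed-+ S (IsSubspace.closed-· S (ls zero) (u∈W zero))
                                    (lin-closed S (u ∘ suc) (u∈W ∘ suc) (ls ∘ suc))

  FirstZero : ∀ {r} → (Pt F (suc r) → Set) → Pt F r → Set
  FirstZero W y = W (0# ◃ y)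

  firstZero-subspace : ∀ {r} {W : Pt F (suc r) → Set} → IsSubspace W → IsSubspace (FirstZero W)
  firstZero-subspace S = record
    { decide   = λ y → decide (0# ◃ y)
    ; respects = λ x≐y → respects (◃-cong x≐y)
    ; has-0    = respects (λ { zero → refl ; (suc j) → refl }) has-0
    ; closed-+ = λ Wx Wy → respects (λ { zero → +-identityˡ 0# ; (suc j) → refl }) (closed-+ Wx Wy)
    ; closed-· = λ t Wx → respects (λ { zero → zeroʳ t ; (suc j) → refl }) (closed-· t Wx)
    }
    where open IsSubspace S

  -- If W contains no vector 1 ◃ y, all of its vectors have first coordinate 0
  -- (otherwise rescale one to first coordinate 1).
  noPivot⇒firstZero : ∀ {r} {W : Pt F (suc r) → Set} → IsSubspace W →
                      ¬ Σ (Pt F r) (λ y → W (1# ◃ y)) → ∀ x → W x → x zero ≈ 0#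
  noPivot⇒firstZero S none x Wx with x zero ≟ 0#
  ... | yes x₀≈0 = x₀≈0
  ... | no x₀≉0 = ⊥-elim (none (x′ ∘ suc , respects rescaled (closed-· t Wx)))
    where
      open IsSubspace S
      t  = proj₁ (inverse (x zero) x₀≉0)
      x′ = t ·ᵥ x
      rescaled : x′ ≐ (1# ◃ (x′ ∘ suc))
      rescaled zero    = trans (*-comm t (x zero)) (proj₂ (inverse (x zero) x₀≉0))
      rescaled (suc j) = refl

  extendBasis : ∀ {r} {W : Pt F (suc r) → Set} → IsSubspace W → Basis (FirstZero W) →
                (y : Pt F r) → W (1# ◃ y) → Basis W
  extendBasis {r} {W} S B y pivot = record
    { dim = suc dim ; vec = U ; independent = U-independent ; inside = U-inside ; spans = U-spans }
    where
      open IsSubspace S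
      open Basis B
      U : Fin (suc dim) → Pt F (suc r)
      U zero    = 1# ◃ y
      U (suc k) = 0# ◃ vec k

      U-inside : ∀ k → W (U k)
      U-inside zero    = pivot
      U-inside (suc k) = inside k

      U-independent : LinIndep F U
      U-independent ls vanish zero = begin
        ls zero                                            ≈⟨ trans (+-identityʳ _) (*-identityʳ _) ⟨
        ls zero * 1# + 0#                                  ≈⟨ +-congˡ (lin-first-zero vec (ls ∘ suc)) ⟨
        ls zero * 1# + lin (U ∘ suc) (ls ∘ suc) zero       ≈⟨ vanish zero ⟩
        0#                                                 ∎
      U-independent ls vanish (suc k) =
        independent (ls ∘ suc) (λ j → absorb-0 (trans (*-congʳ (U-independent ls vanish zero)) (zeroˡ _))
                                               (vanish (suc j))) k

      -- x = t (1 ◃ y) + z where t = x₀ and z ∈ FirstZero W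
      U-spans : ∀ x → W x → Σ (Pt F (suc dim)) λ ls → x ≐ lin U ls
      U-spans x Wx = (t ◃ ls) , coordinates
        where
          t : Carrier
          t = x zero
          z : Pt F (suc r)
          z = x +ᵥ ((- t) ·ᵥ (1# ◃ y))
          z∈ : FirstZero W (z ∘ suc)
          z∈ = respects (first-zero z (trans (+-congˡ (*-identityʳ (- t))) (-‿inverseʳ t)))
                        (closed-+ Wx (closed-· (- t) pivot))
          ls : Pt F dim
          ls = proj₁ (spans _ z∈)
          coordinates : x ≐ lin U (t ◃ ls)
          coordinates zero = sym (begin
            t * 1# + lin (U ∘ suc) ls zero ≈⟨ +-cong (*-identityʳ t) (lin-first-zero vec ls) ⟩
            t + 0#                         ≈⟨ +-identityʳ t ⟩
            t                              ∎)
          coordinates (suc j) = sym (begin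
            t * y j + lin vec ls j           ≈⟨ +-congˡ (proj₂ (spans _ z∈) j) ⟨
            t * y j + (x (suc j) + - t * y j) ≈⟨ +-congˡ (+-congˡ (-‿distribˡ-* t (y j))) ⟨
            t * y j + (x (suc j) - t * y j)  ≈⟨ +-assoc _ _ _ ⟨
            t * y j + x (suc j) - t * y j    ≈⟨ xyx⁻¹≈y _ _ ⟩
            x (suc j)                        ∎)

  liftBasis : ∀ {r} {W : Pt F (suc r) → Set} → IsSubspace W → Basis (FirstZero W) →
              (∀ x → W x → x zero ≈ 0#) → Basis W
  liftBasis {r} {W} S B W-firstZero = record
    { dim = dim ; vec = U ; independent = λ ls vanish → independent ls (vanish ∘ suc)
    ; inside = inside ; spans = U-spans }
    where
      open IsSubspace S
      open Basis B
      U : Fin dim → Pt F (suc r)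
      U k = 0# ◃ vec k

      U-spans : ∀ x → W x → Σ (Pt F dim) λ ls → x ≐ lin U ls
      U-spans x Wx = ls , coordinates
        where
          tail∈ : FirstZero W (x ∘ suc)
          tail∈ = respects (first-zero x (W-firstZero x Wx)) Wx
          ls : Pt F dim
          ls = proj₁ (spans _ tail∈)
          coordinates : x ≐ lin U ls
          coordinates zero    = trans (W-firstZero x Wx) (sym (lin-first-zero vec ls))
          coordinates (suc j) = proj₂ (spans _ tail∈) j

  -- Every decidable subspace of F^r has a basis (induction on r, splitting off the first coordinate).
  basis : ∀ r {W : Pt F r → Set} → IsSubspace W → Basis W
  basis zero S = record
    { dim = 0 ; vec = λ () ; independent = λ _ _ () ; inside = λ () ; spans = λ _ _ → (λ ()) , (λ ()) }
  basis (suc r) {W} S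
    with search r (λ y → W (1# ◃ y)) (λ y → decide (1# ◃ y)) (λ x≐y → respects (◃-cong x≐y))
    where open IsSubspace S
  ... | yes (y , pivot) = extendBasis S (basis r (firstZero-subspace S)) y pivot
  ... | no none         = liftBasis S (basis r (firstZero-subspace S)) (noPivot⇒firstZero S none)

  module Translate {r} {W Z : Pt F r → Set} (S : IsSubspace W) (B : Basis W) (p : Pt F r)
           (Z-resp : ∀ {x y} → x ≐ y → Z x → Z y)
           (Z⇒W : ∀ y → Z (p +ᵥ y) → W y) (W⇒Z : ∀ y → W y → Z (p +ᵥ y)) where
    open Basis B

    Z⇒affComb : ∀ x → Z x → Σ (Pt F dim) λ ls → x ≐ affComb F p vec ls
    Z⇒affComb x Zx =
      let (ls , x-p≐) = spans _ x-p∈W in ls , λ j → trans (sym (a+[b-a]≈b (p j) (x j))) (+-congˡ (x-p≐ j))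
      where
        x-p∈W : W (λ j → x j - p j)
        x-p∈W = Z⇒W _ (Z-resp (λ j → sym (a+[b-a]≈b (p j) (x j))) Zx)

    affComb⇒Z : ∀ x → Σ (Pt F dim) (λ ls → x ≐ affComb F p vec ls) → Z x
    affComb⇒Z x (ls , x≐) = Z-resp (λ j → sym (x≐ j)) (W⇒Z _ (lin-closed S vec inside ls))

    affPoint : Fin (q ^ dim) → Pt F r
    affPoint k = affComb F p vec (point dim k)

    affPoint∈Z : ∀ k → Z (affPoint k)
    affPoint∈Z k = affComb⇒Z _ (point dim k , λ j → refl)

    affPoint-injective : ∀ {k k′} → affPoint k ≐ affPoint k′ → k ≡ k′
    affPoint-injective same =
      point-injective dim (lin-injective independent (λ j → ∙-cancelˡ (p j) _ _ (same j)))

    affPoint-onto : ∀ x → Z x → Σ (Fin (q ^ dim)) λ k → affPoint k ≐ x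
    affPoint-onto x Zx =
      let (ls , x≐) = Z⇒affComb x Zx
          (k , k↦ls) = point-onto dim ls
      in k , λ j → trans (+-congˡ (lin-cong vec k↦ls j)) (sym (x≐ j))

module Zeros {qk : ℕ} (K : FiniteField qk) where
  open FiniteField K using (Carrier; _≈_; _≟_; 0#)
  open import Data.Nat.Properties using (+-suc)

  zeros : ∀ {n} → (Fin n → Carrier) → ℕ
  zeros {zero}  c = 0
  zeros {suc n} c with c zero ≟ 0#
  ... | yes _ = suc (zeros (c ∘ suc))
  ... | no  _ = zeros (c ∘ suc)

  wt+zeros : ∀ {n} (c : Fin n → Carrier) → wt K c ℕ.+ zeros c ≡ n
  wt+zeros {zero}  c = ≡.refl
  wt+zeros {suc n} c with c zero ≟ 0#
  ... | yes _ = ≡.trans (+-suc (wt K (c ∘ suc)) _) (cong suc (wt+zeros (c ∘ suc)))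
  ... | no  _ = cong suc (wt+zeros (c ∘ suc))

  zeroAt : ∀ {n} (c : Fin n → Carrier) → Fin (zeros c) → Fin n
  zeroAt {suc n} c k       with c zero ≟ 0#
  zeroAt {suc n} c zero    | yes _ = zero
  zeroAt {suc n} c (suc k) | yes _ = suc (zeroAt (c ∘ suc) k)
  zeroAt {suc n} c k       | no  _ = suc (zeroAt (c ∘ suc) k)

  zeroAt-zero : ∀ {n} (c : Fin n → Carrier) k → c (zeroAt c k) ≈ 0#
  zeroAt-zero {suc n} c k       with c zero ≟ 0#
  zeroAt-zero {suc n} c zero    | yes c₀≈0 = c₀≈0
  zeroAt-zero {suc n} c (suc k) | yes _ = zeroAt-zero (c ∘ suc) k
  zeroAt-zero {suc n} c k       | no  _ = zeroAt-zero (c ∘ suc) k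

  zeroAt-injective : ∀ {n} (c : Fin n → Carrier) → Injective _≡_ _≡_ (zeroAt c)
  zeroAt-injective {suc n} c {k} {k′} eq with c zero ≟ 0#
  zeroAt-injective {suc n} c {zero}  {zero}   eq | yes _ = ≡.refl
  zeroAt-injective {suc n} c {suc k} {suc k′} eq | yes _ =
    cong suc (zeroAt-injective (c ∘ suc) (FinP.suc-injective eq))
  zeroAt-injective {suc n} c {k} {k′} eq | no _ = zeroAt-injective (c ∘ suc) (FinP.suc-injective eq)

  zeroAt-onto : ∀ {n} (c : Fin n → Carrier) i → c i ≈ 0# → Σ (Fin (zeros c)) λ k → zeroAt c k ≡ i
  zeroAt-onto {suc n} c i       ci≈0 with c zero ≟ 0#
  zeroAt-onto {suc n} c zero    ci≈0 | yes _ = zero , ≡.refl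
  zeroAt-onto {suc n} c (suc i) ci≈0 | yes _ with zeroAt-onto (c ∘ suc) i ci≈0
  ... | k , eq = suc k , cong suc eq
  zeroAt-onto {suc n} c zero    ci≈0 | no c₀≉0 = ⊥-elim (c₀≉0 ci≈0)
  zeroAt-onto {suc n} c (suc i) ci≈0 | no _ with zeroAt-onto (c ∘ suc) i ci≈0
  ... | k , eq = k , cong suc eq

  some-zero : ∀ {n} (c : Fin n → Carrier) → ¬ zeros c ≡ 0 → Σ (Fin n) λ i → c i ≈ 0#
  some-zero c nonempty with zeros c | zeroAt c | zeroAt-zero c
  ... | zero  | _  | _       = ⊥-elim (nonempty ≡.refl)
  ... | suc _ | at | at-zero = at zero , at-zero zero

  zeros-count : ∀ {n a} (c : Fin n → Carrier) (g : Fin a → Fin n) → Injective _≡_ _≡_ g →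
                (∀ k → c (g k) ≈ 0#) → (∀ i → c i ≈ 0# → Σ (Fin a) λ k → g k ≡ i) → a ≡ zeros c
  zeros-count {n} {a} c g g-injective g-zero g-onto =
    FinP.cantor-schröder-bernstein {f = index} {g = preimage} index-injective preimage-injective
    where
      index : Fin a → Fin (zeros c)
      index k = proj₁ (zeroAt-onto c (g k) (g-zero k))
      preimage : Fin (zeros c) → Fin a
      preimage k = proj₁ (g-onto (zeroAt c k) (zeroAt-zero c k))
      index-injective : Injective _≡_ _≡_ index
      index-injective {k} {k′} eq = g-injective (≡.trans (≡.sym (proj₂ (zeroAt-onto c (g k) (g-zero k))))
        (≡.trans (cong (zeroAt c) eq) (proj₂ (zeroAt-onto c (g k′) (g-zero k′)))))
      preimage-injective : Injective _≡_ _≡_ preimage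
      preimage-injective {k} {k′} eq = zeroAt-injective c (≡.trans (≡.sym (proj₂ (g-onto (zeroAt c k) _)))
        (≡.trans (cong g eq) (proj₂ (g-onto (zeroAt c k′) _))))

module PowerArithmetic where
  open import Data.Nat using (_+_; _*_)
  open import Data.Nat.Properties
  open import Data.Nat.Primality using (prime)
  open import Relation.Binary.Definitions using (tri<; tri≈; tri>)
  open ≡.≡-Reasoning

  primePower>1 : ∀ q → IsPrimePower q → 1 < q
  primePower>1 q (p , k , prime {{p-nontrivial}} _ , ≡.refl) =
    <-≤-trans (ℕ.nonTrivial⇒n>1 p)
      (m≤m*n p (p ^ k) {{m^n≢0 p k {{ℕ.nonTrivial⇒nonZero p}}}})

  ^-injective : ∀ {q} → 1 < q → ∀ {a b} → q ^ a ≡ q ^ b → a ≡ b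
  ^-injective {q} 1<q {a} {b} eq with <-cmp a b
  ... | tri< a<b _ _ = ⊥-elim (<-irrefl eq (^-monoʳ-< q 1<q a<b))
  ... | tri≈ _ a≡b _ = a≡b
  ... | tri> _ _ b<a = ⊥-elim (<-irrefl (≡.sym eq) (^-monoʳ-< q 1<q b<a))

  zeros-equation : ∀ q r m w z → w + z ≡ q ^ r → w * q ^ m + q ^ r ≡ q ^ (r + m) → z * q ^ m ≡ q ^ r
  zeros-equation q r m w z w+z≡q^r weight = ≡.sym (+-cancelˡ-≡ (w * q ^ m) _ _ (begin
    w * q ^ m + q ^ r     ≡⟨ weight ⟩
    q ^ (r + m)           ≡⟨ ^-distribˡ-+-* q r m ⟩
    q ^ r * q ^ m         ≡⟨ cong (_* q ^ m) w+z≡q^r ⟨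
    (w + z) * q ^ m       ≡⟨ *-distribʳ-+ (q ^ m) w z ⟩
    w * q ^ m + z * q ^ m ∎))

  zeros-nonempty : ∀ {q r m z} → 1 < q → z * q ^ m ≡ q ^ r → ¬ z ≡ 0
  zeros-nonempty {q@(suc _)} {r} 1<q eq ≡.refl = <-irrefl eq (m^n>0 q r)

  codimension : ∀ {q r m d} → 1 < q → q ^ d * q ^ m ≡ q ^ r → d + m ≡ r
  codimension {q} {m = m} {d} 1<q eq = ^-injective 1<q (≡.trans (^-distribˡ-+-* q d m) eq)

module CodeWord {q m r : ℕ} (F : FiniteField q) (E : Extension F m)
                (a : Fin (suc r) → FiniteField.Carrier (Extension.K E)) where
  open Space F using (_≐_; _+ᵥ_; _·ᵥ_; IsSubspace)
  private
    module F = Space F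
    module K = Space (Extension.K E)
  open Extension E using (ι; ι-hom)
  open MorphismStructures.RingMorphisms.IsRingHomomorphism ι-hom
  open SetoidReasoning K.setoid

  L : Pt F r → K.Carrier
  L x = ∑ (Extension.K E) r (λ j → a (suc j) K.* ι (x j))

  φ : Pt F r → K.Carrier
  φ x = a zero K.* ι F.1# K.+ L x

  L-cong : ∀ {x y} → x ≐ y → L x K.≈ L y
  L-cong x≐y = K.∑-cong r (λ j → K.*-congˡ (⟦⟧-cong (x≐y j)))

  φ-cong : ∀ {x y} → x ≐ y → φ x K.≈ φ y
  φ-cong x≐y = K.+-congˡ (L-cong x≐y)

  L-+ : ∀ x y → L (x +ᵥ y) K.≈ L x K.+ L y
  L-+ x y = K.trans (K.∑-cong r (λ j → K.trans (K.*-congˡ (+-homo (x j) (y j))) (K.distribˡ _ _ _)))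
                    (K.∑-+ r _ _)

  L-· : ∀ t x → L (t ·ᵥ x) K.≈ ι t K.* L x
  L-· t x = K.trans (K.∑-cong r λ j → begin
      a (suc j) K.* ι (t F.* x j)       ≈⟨ K.*-congˡ (*-homo t (x j)) ⟩
      a (suc j) K.* (ι t K.* ι (x j))   ≈⟨ K.*-assoc _ _ _ ⟨
      (a (suc j) K.* ι t) K.* ι (x j)   ≈⟨ K.*-congʳ (K.*-comm _ _) ⟩
      (ι t K.* a (suc j)) K.* ι (x j)   ≈⟨ K.*-assoc _ _ _ ⟩
      ι t K.* (a (suc j) K.* ι (x j))   ∎)
    (K.∑-* r (ι t) _)

  kernel : IsSubspace (λ x → L x K.≈ K.0#)
  kernel = record
    { decide   = λ x → L x K.≟ K.0#
    ; respects = λ x≐y Lx≈0 → K.trans (K.sym (L-cong x≐y)) Lx≈0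
    ; has-0    = K.∑-zero r (λ j → K.trans (K.*-congˡ 0#-homo) (K.zeroʳ _))
    ; closed-+ = λ Lx≈0 Ly≈0 → K.trans (L-+ _ _) (K.trans (K.+-cong Lx≈0 Ly≈0) (K.+-identityˡ K.0#))
    ; closed-· = λ t Lx≈0 → K.trans (L-· t _) (K.trans (K.*-congˡ Lx≈0) (K.zeroʳ _))
    }

  φ-shift : ∀ p y → φ (p +ᵥ y) K.≈ φ p K.+ L y
  φ-shift p y = K.trans (K.+-congˡ (L-+ p y)) (K.sym (K.+-assoc _ _ _))

module ZeroSet {q m r : ℕ} (F : FiniteField q) (E : Extension F m)
  (v : Fin (q ^ r) → Pt F r)
  (v-injective : ∀ i j → _≈ᵥ_ F (v i) (v j) → i ≡ j)
  (v-onto : ∀ x → Σ (Fin (q ^ r)) (λ i → _≈ᵥ_ F (v i) x))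
  (c : Fin (q ^ r) → FiniteField.Carrier (Extension.K E))
  (a : Fin (suc r) → FiniteField.Carrier (Extension.K E))
  (c≈φv : ∀ i → FiniteField._≈_ (Extension.K E) (c i)
            (∑ (Extension.K E) (suc r) (λ j → FiniteField._*_ (Extension.K E) (a j) (Extension.ι E (genRM F v j i)))))
  where
  open Space F
  module K = Space (Extension.K E)
  open CodeWord F E a
  open Zeros (Extension.K E) using (zeros; zeros-count)

  Z : Pt F r → Set
  Z x = Σ (Fin (q ^ r)) (λ i → v i ≐ x × c i K.≈ K.0#)

  Z-resp : ∀ {x y} → x ≐ y → Z x → Z y
  Z-resp x≐y (i , vi≐x , ci≈0) = i , (λ j → trans (vi≐x j) (x≐y j)) , ci≈0

  Z⇒φ : ∀ x → Z x → φ x K.≈ K.0#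
  Z⇒φ x (i , vi≐x , ci≈0) = K.trans (K.sym (φ-cong vi≐x)) (K.trans (K.sym (c≈φv i)) ci≈0)

  Z-at : ∀ i → c i K.≈ K.0# → Z (v i)
  Z-at i ci≈0 = i , (λ j → refl) , ci≈0

  φ⇒Z : ∀ x → φ x K.≈ K.0# → Z x
  φ⇒Z x φx≈0 = let (i , vi≐x) = v-onto x in
    i , vi≐x , K.trans (c≈φv i) (K.trans (φ-cong vi≐x) φx≈0)

  module FromZero (p : Pt F r) (φp≈0 : φ p K.≈ K.0#) where
    B : Basis (λ x → L x K.≈ K.0#)
    B = basis r kernel
    open Basis B public

    translate⇒kernel : ∀ y → Z (p +ᵥ y) → L y K.≈ K.0#
    translate⇒kernel y p+y∈Z = K.absorb-0 φp≈0 (K.trans (K.sym (φ-shift p y)) (Z⇒φ _ p+y∈Z))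

    kernel⇒translate : ∀ y → L y K.≈ K.0# → Z (p +ᵥ y)
    kernel⇒translate y Ly≈0 = φ⇒Z _ (K.trans (φ-shift p y) (K.trans (K.+-cong φp≈0 Ly≈0) (K.+-identityˡ K.0#)))

    private module Z-translate = Translate kernel B p Z-resp translate⇒kernel kernel⇒translate
    open Z-translate public using (Z⇒affComb; affComb⇒Z)
    open Z-translate using (affPoint; affPoint∈Z; affPoint-injective; affPoint-onto)

    index : Fin (q ^ dim) → Fin (q ^ r)
    index k = proj₁ (v-onto (affPoint k))

    zero-count : q ^ dim ≡ zeros c
    zero-count = zeros-count c index index-injective index-zero index-onto
      where
        index-injective : Injective _≡_ _≡_ index
        index-injective {k} {k′} eq = affPoint-injective λ j →
          trans (sym (proj₂ (v-onto (affPoint k)) j))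
            (trans (reflexive (cong (λ i → v i j) eq)) (proj₂ (v-onto (affPoint k′)) j))
        index-zero : ∀ k → c (index k) K.≈ K.0#
        index-zero k = K.trans (c≈φv (index k))
          (K.trans (φ-cong (proj₂ (v-onto (affPoint k)))) (Z⇒φ _ (affPoint∈Z k)))
        index-onto : ∀ i → c i K.≈ K.0# → Σ (Fin (q ^ dim)) λ k → index k ≡ i
        index-onto i ci≈0 = let (k , affPoint≐vi) = affPoint-onto (v i) (Z-at i ci≈0) in
          k , v-injective (index k) i (λ j → trans (proj₂ (v-onto (affPoint k)) j) (affPoint≐vi j))

open PowerArithmetic
open import Data.Nat using (_+_; _*_)

mainTheorem7 : (q s m : ℕ) → IsPrimePower q → 2 ≤ s → 1 ≤ m →
    (F : FiniteField q) (E : Extension F m) →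
    (v : Fin (q ^ (s ∸ 1)) → Pt F (s ∸ 1)) →
    (∀ i j → _≈ᵥ_ F (v i) (v j) → i ≡ j) →
    (∀ x → Σ (Fin (q ^ (s ∸ 1))) (λ i → _≈ᵥ_ F (v i) x)) →
    (c : Fin (q ^ (s ∸ 1)) → FiniteField.Carrier (Extension.K E)) →
    InExtensionCode E (genRM F v) c →
    wt (Extension.K E) c * q ^ m + q ^ (s ∸ 1) ≡ q ^ ((s ∸ 1) + m) →
    IsAffineSubspaceOfCodim F (s ∸ 1) m
    (λ x → Σ (Fin (q ^ (s ∸ 1)))
    (λ i → _≈ᵥ_ F (v i) x × FiniteField._≈_ (Extension.K E) (c i) (FiniteField.0# (Extension.K E))))
mainTheorem7 q s m q-primePower _ _ F E v v-injective v-onto c (a , c≈φv) weight =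
  dim , codim , v (proj₁ zero₀) , vec , independent , λ x → Z⇒affComb x , affComb⇒Z x
  where
    module K = FiniteField (Extension.K E)
    open Zeros (Extension.K E) using (zeros; wt+zeros; some-zero)
    open ZeroSet F E v v-injective v-onto c a c≈φv using (Z-at; Z⇒φ; module FromZero)

    r : ℕ
    r = s ∸ 1

    1<q : 1 < q
    1<q = primePower>1 q q-primePower

    zeros*q^m≡q^r : zeros c * q ^ m ≡ q ^ r
    zeros*q^m≡q^r = zeros-equation q r m (wt (Extension.K E) c) (zeros c) (wt+zeros c) weight

    zero₀ : Σ (Fin (q ^ r)) λ i → c i K.≈ K.0#
    zero₀ = some-zero c (zeros-nonempty {r = r} {m = m} 1<q zeros*q^m≡q^r)

    open FromZero (v (proj₁ zero₀)) (Z⇒φ _ (Z-at (proj₁ zero₀) (proj₂ zero₀)))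

    codim : dim + m ≡ r
    codim = codimension {d = dim} 1<q (≡.trans (cong (_* q ^ m) zero-count) zeros*q^m≡q^r)
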